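{- Let $P$ be a process such that $\vdash P \triangleright \mathtt{l}:\mathtt{end},\ \mathtt{r}:\mathtt{end}$ is derivable in the empty typing environment. Then $P$ is correct, i.e. whenever $P \longrightarrow^* Q$ and $Q$ has no reduction ($Q \not\longrightarrow$), we have $Q \equiv \mathbf{0}$.
   Context: Channels: $\mathsf{c}$ ranges over $\{\mathtt{l},\mathtt{r}\}$, with involution $\bar{\mathtt{l}}=\mathtt{r}$, $\bar{\mathtt{r}}=\mathtt{l}$. Selectors: $\ell\in\{\mathsf{inl},\mathsf{inr}\}$. There are basic values and basic types, including the value $()$ of type $\mathsf{unit}$, the booleans $\mathsf{true},\mathsf{false}$ of type $\mathsf{bool}$, and the integers of type $\mathsf{int}$; $v\in t$ means that the basic value $v$ has basic type $t$. Expressions $e$ are variables $x$, basic values $v$, or equalities $e_1=e_2$; a deterministic evaluation relation $e\Downarrow v$ states that $v$ is the value of $e$. Processes: $P ::= \mathbf{0} \mid \mathsf{c}?(x:t).P \mid \mathsf{c}!e.P \mid \mathsf{c}\triangleleft\ell.P \mid \mathsf{c}\triangleright\{P,Q\} \mid \mathsf{if}\ e\ \mathsf{then}\ P\ \mathsf{else}\ Q \mid P\bowtie Q$ (input, output, selection, branching with an $\mathsf{inl}$-branch $P$ and an $\mathsf{inr}$-branch $Q$, conditional, composition). In $P\bowtie Q$, messages sent by $P$ on $\mathtt{r}$ are received by $Q$ on $\mathtt{l}$ and vice versa. Structural congruence $\equiv$ is the least congruence with $\mathbf{0}\bowtie\mathbf{0}\equiv\mathbf{0}$ and $P\bowtie(Q\bowtie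 R)\equiv(P\bowtie Q)\bowtie R$. Reduction contexts: $\mathcal{C} ::= [\,] \mid \mathcal{C}\bowtie P \mid P\bowtie\mathcal{C}$. Reduction $\longrightarrow$ is the least relation with: $\mathtt{r}!e.P\bowtie\mathtt{l}?(x:t).Q \longrightarrow P\bowtie Q\{v/x\}$ and $\mathtt{r}?(x:t).P\bowtie\mathtt{l}!e.Q\longrightarrow P\{v/x\}\bowtie Q$, both when $e\Downarrow v$ and $v\in t$; $\mathtt{r}\triangleleft\ell.P\bowtie\mathtt{l}\triangleright\{Q_{\mathsf{inl}},Q_{\mathsf{inr}}\}\longrightarrow P\bowtie Q_\ell$; $\mathtt{r}\triangleright\{P_{\mathsf{inl}},P_{\mathsf{inr}}\}\bowtie\mathtt{l}\triangleleft\ell.Q\longrightarrow P_\ell\bowtie Q$; $\mathsf{if}\ e\ \mathsf{then}\ P_{\mathsf{true}}\ \mathsf{else}\ P_{\mathsf{false}}\longrightarrow P_v$ when $e\Downarrow v$, $v\in\mathsf{bool}$; closure under reduction contexts; and closure under $\equiv$ on both sides. $\longrightarrow^*$ is the reflexive-transitive closure. Session types: $T ::= \mathtt{end} \mid ?t.T \mid !t.T \mid T+S \mid T\oplus S$ (input, output, branching, selection). Typing environments $\Gamma$ map variables to basic types. Judgments: $\Gamma\vdash e:t$, and $\Gamma\vdash P\triangleright \mathsf{c}:T,\bar{\mathsf{c}}:S$ meaning $P$ uses channel $\mathsf{c}$ according to $T$ and $\bar{\mathsf{c}}$ according to $S$. Rules: $\Gamma,x:t\vdash x:t$; $\Gamma\vdash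 v:t$ if $v\in t$; $\Gamma\vdash e_1=e_2:\mathsf{bool}$ if $\Gamma\vdash e_1:t$ and $\Gamma\vdash e_2:t$. If $\Gamma,x:t\vdash P\triangleright\mathsf{c}:T,\bar{\mathsf{c}}:S$ then $\Gamma\vdash\mathsf{c}?(x:t).P\triangleright\mathsf{c}:?t.T,\bar{\mathsf{c}}:S$. If $\Gamma\vdash e:t$ and $\Gamma\vdash P\triangleright\mathsf{c}:T,\bar{\mathsf{c}}:S$ then $\Gamma\vdash\mathsf{c}!e.P\triangleright\mathsf{c}:!t.T,\bar{\mathsf{c}}:S$. If $\Gamma\vdash P_i\triangleright\mathsf{c}:T_i,\bar{\mathsf{c}}:S$ for $i=1,2$ then $\Gamma\vdash\mathsf{c}\triangleright\{P_1,P_2\}\triangleright\mathsf{c}:T_1+T_2,\bar{\mathsf{c}}:S$. If $\Gamma\vdash P\triangleright\mathsf{c}:T_1,\bar{\mathsf{c}}:S$ then $\Gamma\vdash\mathsf{c}\triangleleft\mathsf{inl}.P\triangleright\mathsf{c}:T_1\oplus T_2,\bar{\mathsf{c}}:S$; if $\Gamma\vdash P\triangleright\mathsf{c}:T_2,\bar{\mathsf{c}}:S$ then $\Gamma\vdash\mathsf{c}\triangleleft\mathsf{inr}.P\triangleright\mathsf{c}:T_1\oplus T_2,\bar{\mathsf{c}}:S$. $\Gamma\vdash\mathbf{0}\triangleright\mathtt{l}:\mathtt{end},\mathtt{r}:\mathtt{end}$. If $\Gamma\vdash e:\mathsf{bool}$ and $\Gamma\vdash P_i\triangleright\mathtt{l}:T,\mathtt{r}:S$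 ($i=1,2$) then $\Gamma\vdash\mathsf{if}\ e\ \mathsf{then}\ P_1\ \mathsf{else}\ P_2\triangleright\mathtt{l}:T,\mathtt{r}:S$. If $\Gamma\vdash P\triangleright\mathtt{l}:T,\mathtt{r}:T'$ and $\Gamma\vdash Q\triangleright\mathtt{l}:\overline{T'},\mathtt{r}:S$ then $\Gamma\vdash P\bowtie Q\triangleright\mathtt{l}:T,\mathtt{r}:S$, where $\overline{T'}$ is the dual of $T'$ (obtained by swapping inputs with outputs and branchings with selections). -}

module Defs where

open import Data.Nat using (ℕ; _≟_)
open import Data.Integer using (ℤ)
open import Data.Bool using (Bool; true; false)
open import Data.Maybe using (Maybe; just; nothing)
open import Data.Product using (∃; _×_; _,_)
open import Relation.Binary.PropositionalEquality using (_≡_; _≢_)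
open import Relation.Nullary using (¬_; yes; no)

data Chan : Set where
  l r : Chan

bar : Chan → Chan
bar l = r
bar r = l

data Sel : Set where
  inl inr : Sel

data BType : Set where
  unitT boolT intT : BType

data Val : Set where
  unitV : Val
  boolV : Bool → Val
  intV  : ℤ → Val

data _∈ᵥ_ : Val → BType → Set where
  unit∈ : unitV ∈ᵥ unitT
  bool∈ : ∀ {b} → boolV b ∈ᵥ boolT
  int∈  : ∀ {z} → intV z ∈ᵥ intT

Var : Set
Var = ℕ

data Expr : Set where
  var  : Var → Expr
  val  : Val → Expr
  _==_ : Expr → Expr → Expr

data _⇓_ : Expr → Val → Set where
  ⇓val   : ∀ {v} → val v ⇓ v
  ⇓eqT   : ∀ {e₁ e₂ v} → e₁ ⇓ v → e₂ ⇓ v → (e₁ == e₂) ⇓ boolV true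
  ⇓eqF   : ∀ {e₁ e₂ v₁ v₂} → e₁ ⇓ v₁ → e₂ ⇓ v₂ → v₁ ≢ v₂ → (e₁ == e₂) ⇓ boolV false

data Proc : Set where
  𝟎      : Proc
  inp    : Chan → Var → BType → Proc → Proc
  out    : Chan → Expr → Proc → Proc
  sel    : Chan → Sel → Proc → Proc
  bra    : Chan → Proc → Proc → Proc
  ifte   : Expr → Proc → Proc → Proc
  _⋈_    : Proc → Proc → Proc

infixl 5 _⋈_

substE : Expr → Val → Var → Expr
substE (var y) v x with y ≟ x
... | yes _ = val v
... | no  _ = var y
substE (val w) v x = val w
substE (e₁ == e₂) v x = substE e₁ v x == substE e₂ v x

subst : Proc → Val → Var → Proc
subst 𝟎 v x = 𝟎
subst (inp c y t P) v x with y ≟ x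
... | yes _ = inp c y t P
... | no  _ = inp c y t (subst P v x)
subst (out c e P) v x = out c (substE e v x) (subst P v x)
subst (sel c ℓ P) v x = sel c ℓ (subst P v x)
subst (bra c P Q) v x = bra c (subst P v x) (subst Q v x)
subst (ifte e P Q) v x = ifte (substE e v x) (subst P v x) (subst Q v x)
subst (P ⋈ Q) v x = subst P v x ⋈ subst Q v x

branch : Sel → Proc → Proc → Proc
branch inl P Q = P
branch inr P Q = Q

ifBranch : Bool → Proc → Proc → Proc
ifBranch true  P Q = P
ifBranch false P Q = Q

data _≡ₛ_ : Proc → Proc → Set where
  ≡-unit   : (𝟎 ⋈ 𝟎) ≡ₛ 𝟎
  ≡-assoc  : ∀ {P Q R} → (P ⋈ (Q ⋈ R)) ≡ₛ ((P ⋈ Q) ⋈ R)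
  ≡-refl   : ∀ {P} → P ≡ₛ P
  ≡-sym    : ∀ {P Q} → P ≡ₛ Q → Q ≡ₛ P
  ≡-trans  : ∀ {P Q R} → P ≡ₛ Q → Q ≡ₛ R → P ≡ₛ R
  ≡-inp    : ∀ {c x t P P'} → P ≡ₛ P' → inp c x t P ≡ₛ inp c x t P'
  ≡-out    : ∀ {c e P P'} → P ≡ₛ P' → out c e P ≡ₛ out c e P'
  ≡-sel    : ∀ {c ℓ P P'} → P ≡ₛ P' → sel c ℓ P ≡ₛ sel c ℓ P'
  ≡-bra    : ∀ {c P P' Q Q'} → P ≡ₛ P' → Q ≡ₛ Q' → bra c P Q ≡ₛ bra c P' Q'
  ≡-if     : ∀ {e P P' Q Q'} → P ≡ₛ P' → Q ≡ₛ Q' → ifte e P Q ≡ₛ ifte e P' Q'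
  ≡-par    : ∀ {P P' Q Q'} → P ≡ₛ P' → Q ≡ₛ Q' → (P ⋈ Q) ≡ₛ (P' ⋈ Q')

data _⟶_ : Proc → Proc → Set where
  r-comm₁ : ∀ {e P x t Q v} → e ⇓ v → v ∈ᵥ t →
            (out r e P ⋈ inp l x t Q) ⟶ (P ⋈ subst Q v x)
  r-comm₂ : ∀ {x t P e Q v} → e ⇓ v → v ∈ᵥ t →
            (inp r x t P ⋈ out l e Q) ⟶ (subst P v x ⋈ Q)
  r-sel₁  : ∀ {ℓ P Q₁ Q₂} → (sel r ℓ P ⋈ bra l Q₁ Q₂) ⟶ (P ⋈ branch ℓ Q₁ Q₂)
  r-sel₂  : ∀ {P₁ P₂ ℓ Q} → (bra r P₁ P₂ ⋈ sel l ℓ Q) ⟶ (branch ℓ P₁ P₂ ⋈ Q)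
  r-if    : ∀ {e P Q b} → e ⇓ boolV b → ifte e P Q ⟶ ifBranch b P Q
  r-parL  : ∀ {P P' Q} → P ⟶ P' → (P ⋈ Q) ⟶ (P' ⋈ Q)
  r-parR  : ∀ {P Q Q'} → Q ⟶ Q' → (P ⋈ Q) ⟶ (P ⋈ Q')
  r-struct : ∀ {P P' Q' Q} → P ≡ₛ P' → P' ⟶ Q' → Q' ≡ₛ Q → P ⟶ Q

data _⟶*_ : Proc → Proc → Set where
  ⟶*-refl : ∀ {P} → P ⟶* P
  ⟶*-step : ∀ {P Q R} → P ⟶ Q → Q ⟶* R → P ⟶* R

data SType : Set where
  end  : SType
  ?ₛ_∙_ : BType → SType → SType
  !ₛ_∙_ : BType → SType → SType
  _&_  : SType → SType → SType
  _⊕_  : SType → SType → SType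

dual : SType → SType
dual end = end
dual (?ₛ t ∙ T) = !ₛ t ∙ dual T
dual (!ₛ t ∙ T) = ?ₛ t ∙ dual T
dual (T & S) = dual T ⊕ dual S
dual (T ⊕ S) = dual T & dual S

Env : Set
Env = Var → Maybe BType

∅ : Env
∅ _ = nothing

_,,_∶_ : Env → Var → BType → Env
(Γ ,, x ∶ t) y with y ≟ x
... | yes _ = just t
... | no  _ = Γ y

data _⊢ₑ_∶_ : Env → Expr → BType → Set where
  t-var : ∀ {Γ x t} → Γ x ≡ just t → Γ ⊢ₑ var x ∶ t
  t-val : ∀ {Γ v t} → v ∈ᵥ t → Γ ⊢ₑ val v ∶ t
  t-eq  : ∀ {Γ e₁ e₂ t} → Γ ⊢ₑ e₁ ∶ t → Γ ⊢ₑ e₂ ∶ t → Γ ⊢ₑ (e₁ == e₂) ∶ boolT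

-- Process typing  Γ ⊢ P ▷ l:TL , r:TR.
-- A judgment "c:T, c̄:S" is the pair (TL,TR) given by  at c T S.
at : Chan → SType → SType → SType × SType
at l T S = T , S
at r T S = S , T

data _⊢_▷_ : Env → Proc → SType × SType → Set where
  t-inp  : ∀ {Γ c x t P T S} → (Γ ,, x ∶ t) ⊢ P ▷ at c T S →
           Γ ⊢ inp c x t P ▷ at c (?ₛ t ∙ T) S
  t-out  : ∀ {Γ c e t P T S} → Γ ⊢ₑ e ∶ t → Γ ⊢ P ▷ at c T S →
           Γ ⊢ out c e P ▷ at c (!ₛ t ∙ T) S
  t-bra  : ∀ {Γ c P₁ P₂ T₁ T₂ S} → Γ ⊢ P₁ ▷ at c T₁ S → Γ ⊢ P₂ ▷ at c T₂ S →
           Γ ⊢ bra c P₁ P₂ ▷ at c (T₁ & T₂) S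
  t-inl  : ∀ {Γ c P T₁ T₂ S} → Γ ⊢ P ▷ at c T₁ S →
           Γ ⊢ sel c inl P ▷ at c (T₁ ⊕ T₂) S
  t-inr  : ∀ {Γ c P T₁ T₂ S} → Γ ⊢ P ▷ at c T₂ S →
           Γ ⊢ sel c inr P ▷ at c (T₁ ⊕ T₂) S
  t-nil  : ∀ {Γ} → Γ ⊢ 𝟎 ▷ (end , end)
  t-if   : ∀ {Γ e P₁ P₂ T S} → Γ ⊢ₑ e ∶ boolT → Γ ⊢ P₁ ▷ (T , S) → Γ ⊢ P₂ ▷ (T , S) →
           Γ ⊢ ifte e P₁ P₂ ▷ (T , S)
  t-par  : ∀ {Γ P Q T T' S} → Γ ⊢ P ▷ (T , T') → Γ ⊢ Q ▷ (dual T' , S) →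
           Γ ⊢ (P ⋈ Q) ▷ (T , S)

Stuck : Proc → Set
Stuck Q = ¬ (∃ λ Q' → Q ⟶ Q')

Correct : Proc → Set
Correct P = ∀ Q → P ⟶* Q → Stuck Q → Q ≡ₛ 𝟎

-- Type safety by subject reduction and progress. Typing is preserved by
-- structural congruence and by every reduction step, so every reduct of P is
-- typed with l:end, r:end. A closed typed process either reduces, is a
-- composition of 𝟎s, or waits on one of its outer channels l or r — and then
-- its type on that channel is not end. For P ⋈ Q the middle channel is what
-- makes this go through: if P waits on r and Q on l, duality of the middle
-- type forces the two prefixes to match, so they communicate; if one side is
-- finished, the middle type is end and the other side cannot wait on it.
module Submission where

open import Defs
open import Data.Bool using (true; false)
import Data.Bool.Properties as Bool
import Data.Integer.Properties as ℤ
open import Data.Empty using (⊥-elim)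
open import Data.Maybe using (just)
open import Data.Maybe.Properties using (just-injective)
open import Data.Nat using (_≟_)
open import Data.Product using (Σ; ∃; _×_; _,_; proj₁)
open import Relation.Binary.Definitions using (DecidableEquality)
open import Relation.Binary.PropositionalEquality
  using (_≡_; _≢_; _≗_; refl; sym; trans; cong; ≢-sym)
open import Relation.Nullary using (yes; no)
open import Relation.Nullary.Decidable using (map′)

_≟ᵥ_ : DecidableEquality Val
unitV   ≟ᵥ unitV   = yes refl
unitV   ≟ᵥ boolV _ = no λ ()
unitV   ≟ᵥ intV _  = no λ ()
boolV _ ≟ᵥ unitV   = no λ ()
boolV a ≟ᵥ boolV b = map′ (cong boolV) (λ { refl → refl }) (a Bool.≟ b)
boolV _ ≟ᵥ intV _  = no λ ()
intV _  ≟ᵥ unitV   = no λ ()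
intV _  ≟ᵥ boolV _ = no λ ()
intV a  ≟ᵥ intV b  = map′ (cong intV) (λ { refl → refl }) (a ℤ.≟ b)

,,-here : ∀ {Γ} x t → (Γ ,, x ∶ t) x ≡ just t
,,-here x t with x ≟ x
... | yes _   = refl
... | no x≢x = ⊥-elim (x≢x refl)

,,-there : ∀ {Γ x t y} → y ≢ x → (Γ ,, x ∶ t) y ≡ Γ y
,,-there {x = x} {y = y} y≢x with y ≟ x
... | yes y≡x = ⊥-elim (y≢x y≡x)
... | no _    = refl

AgreeOff : Var → Env → Env → Set
AgreeOff x Γ Δ = ∀ y → y ≢ x → Γ y ≡ Δ y

,,-cong : ∀ {Γ Δ x t} → AgreeOff x Γ Δ → (Γ ,, x ∶ t) ≗ (Δ ,, x ∶ t)
,,-cong {x = x} Γ≈Δ y with y ≟ x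
... | yes _   = refl
... | no y≢x = Γ≈Δ y y≢x

,,-preserves-AgreeOff : ∀ {Γ Δ x y t} → AgreeOff x Γ Δ → AgreeOff x (Γ ,, y ∶ t) (Δ ,, y ∶ t)
,,-preserves-AgreeOff {y = y} Γ≈Δ z z≢x with z ≟ y
... | yes _ = refl
... | no _  = Γ≈Δ z z≢x

⊢ₑ-cong : ∀ {Γ Δ e t} → Γ ≗ Δ → Γ ⊢ₑ e ∶ t → Δ ⊢ₑ e ∶ t
⊢ₑ-cong Γ≗Δ (t-var {x = x} Γx) = t-var (trans (sym (Γ≗Δ x)) Γx)
⊢ₑ-cong Γ≗Δ (t-val v∈t)       = t-val v∈t
⊢ₑ-cong Γ≗Δ (t-eq d₁ d₂)      = t-eq (⊢ₑ-cong Γ≗Δ d₁) (⊢ₑ-cong Γ≗Δ d₂)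

⊢-cong : ∀ {Γ Δ P τ} → Γ ≗ Δ → Γ ⊢ P ▷ τ → Δ ⊢ P ▷ τ
⊢-cong Γ≗Δ (t-inp d)        = t-inp (⊢-cong (,,-cong λ y _ → Γ≗Δ y) d)
⊢-cong Γ≗Δ (t-out dₑ d)     = t-out (⊢ₑ-cong Γ≗Δ dₑ) (⊢-cong Γ≗Δ d)
⊢-cong Γ≗Δ (t-bra d₁ d₂)    = t-bra (⊢-cong Γ≗Δ d₁) (⊢-cong Γ≗Δ d₂)
⊢-cong Γ≗Δ (t-inl d)        = t-inl (⊢-cong Γ≗Δ d)
⊢-cong Γ≗Δ (t-inr d)        = t-inr (⊢-cong Γ≗Δ d)
⊢-cong Γ≗Δ t-nil            = t-nil
⊢-cong Γ≗Δ (t-if dₑ d₁ d₂)  = t-if (⊢ₑ-cong Γ≗Δ dₑ) (⊢-cong Γ≗Δ d₁) (⊢-cong Γ≗Δ d₂)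
⊢-cong Γ≗Δ (t-par d₁ d₂)    = t-par (⊢-cong Γ≗Δ d₁) (⊢-cong Γ≗Δ d₂)

⊢ₑ-subst : ∀ {Γ Δ x t v e t'} → AgreeOff x Γ Δ → Γ x ≡ just t → v ∈ᵥ t →
           Γ ⊢ₑ e ∶ t' → Δ ⊢ₑ substE e v x ∶ t'
⊢ₑ-subst {x = x} Γ≈Δ Γx v∈t (t-var {x = y} Γy) with y ≟ x
... | yes refl with just-injective (trans (sym Γx) Γy)
...   | refl = t-val v∈t
⊢ₑ-subst Γ≈Δ Γx v∈t (t-var {x = y} Γy) | no y≢x = t-var (trans (sym (Γ≈Δ y y≢x)) Γy)
⊢ₑ-subst Γ≈Δ Γx v∈t (t-val w∈t')  = t-val w∈t'
⊢ₑ-subst Γ≈Δ Γx v∈t (t-eq d₁ d₂)  = t-eq (⊢ₑ-subst Γ≈Δ Γx v∈t d₁) (⊢ₑ-subst Γ≈Δ Γx v∈t d₂)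

⊢-subst : ∀ {Γ Δ x t v P τ} → AgreeOff x Γ Δ → Γ x ≡ just t → v ∈ᵥ t →
          Γ ⊢ P ▷ τ → Δ ⊢ subst P v x ▷ τ
⊢-subst {x = x} Γ≈Δ Γx v∈t (t-inp {x = y} d) with y ≟ x
... | yes refl = t-inp (⊢-cong (,,-cong Γ≈Δ) d)
... | no y≢x   = t-inp (⊢-subst (,,-preserves-AgreeOff Γ≈Δ) (trans (,,-there (≢-sym y≢x)) Γx) v∈t d)
⊢-subst Γ≈Δ Γx v∈t (t-out dₑ d)    = t-out (⊢ₑ-subst Γ≈Δ Γx v∈t dₑ) (⊢-subst Γ≈Δ Γx v∈t d)
⊢-subst Γ≈Δ Γx v∈t (t-bra d₁ d₂)   = t-bra (⊢-subst Γ≈Δ Γx v∈t d₁) (⊢-subst Γ≈Δ Γx v∈t d₂)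
⊢-subst Γ≈Δ Γx v∈t (t-inl d)       = t-inl (⊢-subst Γ≈Δ Γx v∈t d)
⊢-subst Γ≈Δ Γx v∈t (t-inr d)       = t-inr (⊢-subst Γ≈Δ Γx v∈t d)
⊢-subst Γ≈Δ Γx v∈t t-nil           = t-nil
⊢-subst Γ≈Δ Γx v∈t (t-if dₑ d₁ d₂) =
  t-if (⊢ₑ-subst Γ≈Δ Γx v∈t dₑ) (⊢-subst Γ≈Δ Γx v∈t d₁) (⊢-subst Γ≈Δ Γx v∈t d₂)
⊢-subst Γ≈Δ Γx v∈t (t-par d₁ d₂)   = t-par (⊢-subst Γ≈Δ Γx v∈t d₁) (⊢-subst Γ≈Δ Γx v∈t d₂)

⊢-subst-bound : ∀ {Γ x t v P τ} → (Γ ,, x ∶ t) ⊢ P ▷ τ → v ∈ᵥ t → Γ ⊢ subst P v x ▷ τ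
⊢-subst-bound {x = x} {t} d v∈t = ⊢-subst (λ _ → ,,-there) (,,-here x t) v∈t d

mutual
  ≡ₛ-preserves-⊢ : ∀ {Γ P Q τ} → P ≡ₛ Q → Γ ⊢ P ▷ τ → Γ ⊢ Q ▷ τ
  ≡ₛ-preserves-⊢ ≡-unit            (t-par t-nil t-nil)   = t-nil
  ≡ₛ-preserves-⊢ ≡-assoc           (t-par d₁ (t-par d₂ d₃)) = t-par (t-par d₁ d₂) d₃
  ≡ₛ-preserves-⊢ ≡-refl            d                     = d
  ≡ₛ-preserves-⊢ (≡-sym P≡Q)       d                     = ≡ₛ-reflects-⊢ P≡Q d
  ≡ₛ-preserves-⊢ (≡-trans P≡Q Q≡R) d                     = ≡ₛ-preserves-⊢ Q≡R (≡ₛ-preserves-⊢ P≡Q d)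
  ≡ₛ-preserves-⊢ (≡-inp P≡Q)       (t-inp d)             = t-inp (≡ₛ-preserves-⊢ P≡Q d)
  ≡ₛ-preserves-⊢ (≡-out P≡Q)       (t-out dₑ d)          = t-out dₑ (≡ₛ-preserves-⊢ P≡Q d)
  ≡ₛ-preserves-⊢ (≡-sel P≡Q)       (t-inl d)             = t-inl (≡ₛ-preserves-⊢ P≡Q d)
  ≡ₛ-preserves-⊢ (≡-sel P≡Q)       (t-inr d)             = t-inr (≡ₛ-preserves-⊢ P≡Q d)
  ≡ₛ-preserves-⊢ (≡-bra P≡ Q≡)     (t-bra d₁ d₂)         = t-bra (≡ₛ-preserves-⊢ P≡ d₁) (≡ₛ-preserves-⊢ Q≡ d₂)
  ≡ₛ-preserves-⊢ (≡-if P≡ Q≡)      (t-if dₑ d₁ d₂)       = t-if dₑ (≡ₛ-preserves-⊢ P≡ d₁) (≡ₛ-preserves-⊢ Q≡ d₂)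
  ≡ₛ-preserves-⊢ (≡-par P≡ Q≡)     (t-par d₁ d₂)         = t-par (≡ₛ-preserves-⊢ P≡ d₁) (≡ₛ-preserves-⊢ Q≡ d₂)

  ≡ₛ-reflects-⊢ : ∀ {Γ P Q τ} → P ≡ₛ Q → Γ ⊢ Q ▷ τ → Γ ⊢ P ▷ τ
  ≡ₛ-reflects-⊢ ≡-unit            t-nil                 = t-par t-nil t-nil
  ≡ₛ-reflects-⊢ ≡-assoc           (t-par (t-par d₁ d₂) d₃) = t-par d₁ (t-par d₂ d₃)
  ≡ₛ-reflects-⊢ ≡-refl            d                     = d
  ≡ₛ-reflects-⊢ (≡-sym P≡Q)       d                     = ≡ₛ-preserves-⊢ P≡Q d
  ≡ₛ-reflects-⊢ (≡-trans P≡Q Q≡R) d                     = ≡ₛ-reflects-⊢ P≡Q (≡ₛ-reflects-⊢ Q≡R d)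
  ≡ₛ-reflects-⊢ (≡-inp P≡Q)       (t-inp d)             = t-inp (≡ₛ-reflects-⊢ P≡Q d)
  ≡ₛ-reflects-⊢ (≡-out P≡Q)       (t-out dₑ d)          = t-out dₑ (≡ₛ-reflects-⊢ P≡Q d)
  ≡ₛ-reflects-⊢ (≡-sel P≡Q)       (t-inl d)             = t-inl (≡ₛ-reflects-⊢ P≡Q d)
  ≡ₛ-reflects-⊢ (≡-sel P≡Q)       (t-inr d)             = t-inr (≡ₛ-reflects-⊢ P≡Q d)
  ≡ₛ-reflects-⊢ (≡-bra P≡ Q≡)     (t-bra d₁ d₂)         = t-bra (≡ₛ-reflects-⊢ P≡ d₁) (≡ₛ-reflects-⊢ Q≡ d₂)
  ≡ₛ-reflects-⊢ (≡-if P≡ Q≡)      (t-if dₑ d₁ d₂)       = t-if dₑ (≡ₛ-reflects-⊢ P≡ d₁) (≡ₛ-reflects-⊢ Q≡ d₂)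
  ≡ₛ-reflects-⊢ (≡-par P≡ Q≡)     (t-par d₁ d₂)         = t-par (≡ₛ-reflects-⊢ P≡ d₁) (≡ₛ-reflects-⊢ Q≡ d₂)

subject-reduction : ∀ {Γ P Q τ} → P ⟶ Q → Γ ⊢ P ▷ τ → Γ ⊢ Q ▷ τ
subject-reduction (r-comm₁ _ v∈t) (t-par (t-out _ dP) (t-inp dQ)) = t-par dP (⊢-subst-bound dQ v∈t)
subject-reduction (r-comm₂ _ v∈t) (t-par (t-inp dP) (t-out _ dQ)) = t-par (⊢-subst-bound dP v∈t) dQ
subject-reduction r-sel₁ (t-par (t-inl dP) (t-bra d₁ _))  = t-par dP d₁
subject-reduction r-sel₁ (t-par (t-inr dP) (t-bra _ d₂))  = t-par dP d₂
subject-reduction r-sel₂ (t-par (t-bra d₁ _) (t-inl dQ))  = t-par d₁ dQ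
subject-reduction r-sel₂ (t-par (t-bra _ d₂) (t-inr dQ))  = t-par d₂ dQ
subject-reduction (r-if {b = true} _)  (t-if _ d₁ _)      = d₁
subject-reduction (r-if {b = false} _) (t-if _ _ d₂)      = d₂
subject-reduction (r-parL P⟶) (t-par d₁ d₂) = t-par (subject-reduction P⟶ d₁) d₂
subject-reduction (r-parR Q⟶) (t-par d₁ d₂) = t-par d₁ (subject-reduction Q⟶ d₂)
subject-reduction (r-struct P≡ P⟶ Q≡) d =
  ≡ₛ-preserves-⊢ Q≡ (subject-reduction P⟶ (≡ₛ-preserves-⊢ P≡ d))

subject-reduction* : ∀ {Γ P Q τ} → P ⟶* Q → Γ ⊢ P ▷ τ → Γ ⊢ Q ▷ τ
subject-reduction* ⟶*-refl           d = d
subject-reduction* (⟶*-step P⟶ Q⟶*) d = subject-reduction* Q⟶* (subject-reduction P⟶ d)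

eval-closed : ∀ {e t} → ∅ ⊢ₑ e ∶ t → Σ Val λ v → e ⇓ v × v ∈ᵥ t
eval-closed (t-var ())
eval-closed (t-val v∈t) = _ , ⇓val , v∈t
eval-closed (t-eq d₁ d₂) with eval-closed d₁ | eval-closed d₂
... | v₁ , e₁⇓ , _ | v₂ , e₂⇓ , _ with v₁ ≟ᵥ v₂
...   | yes refl = boolV true  , ⇓eqT e₁⇓ e₂⇓ , bool∈
...   | no v₁≢v₂ = boolV false , ⇓eqF e₁⇓ e₂⇓ v₁≢v₂ , bool∈

Reducible : Proc → Set
Reducible P = ∃ λ P' → P ⟶ P'

data Terminated : Proc → Set where
  𝟎-terminated : Terminated 𝟎
  ⋈-terminated : ∀ {P Q} → Terminated P → Terminated Q → Terminated (P ⋈ Q)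

data Guarded (c : Chan) : Proc → Set where
  inp-guarded : ∀ {x t P} → Guarded c (inp c x t P)
  out-guarded : ∀ {e P}   → Guarded c (out c e P)
  sel-guarded : ∀ {ℓ P}   → Guarded c (sel c ℓ P)
  bra-guarded : ∀ {P Q}   → Guarded c (bra c P Q)

-- A guard on the outer channel c, reached through compositions only on the c
-- side: guards deeper inside face a partner on an internal channel.
data Waiting : Chan → Proc → Set where
  guarded       : ∀ {c P} → Guarded c P → Waiting c P
  waiting-left  : ∀ {P Q} → Waiting l P → Waiting l (P ⋈ Q)
  waiting-right : ∀ {P Q} → Waiting r Q → Waiting r (P ⋈ Q)

data Progress (P : Proc) : Set where
  step       : Reducible P → Progress P
  terminated : Terminated P → Progress P
  waiting    : ∀ c → Waiting c P → Progress P

typeAt : Chan → SType × SType → SType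
typeAt l (T , _) = T
typeAt r (_ , S) = S

typeAt-at-≢end : ∀ c {T S} → T ≢ end → typeAt c (at c T S) ≢ end
typeAt-at-≢end l T≢end = T≢end
typeAt-at-≢end r T≢end = T≢end

terminated-⊢-end : ∀ {Γ P τ} → Terminated P → Γ ⊢ P ▷ τ → τ ≡ (end , end)
terminated-⊢-end 𝟎-terminated t-nil = refl
terminated-⊢-end (⋈-terminated P✓ Q✓) (t-par dP dQ)
  with terminated-⊢-end P✓ dP | terminated-⊢-end Q✓ dQ
... | refl | refl = refl

terminated-≡𝟎 : ∀ {P} → Terminated P → P ≡ₛ 𝟎
terminated-≡𝟎 𝟎-terminated          = ≡-refl
terminated-≡𝟎 (⋈-terminated P✓ Q✓) = ≡-trans (≡-par (terminated-≡𝟎 P✓) (terminated-≡𝟎 Q✓)) ≡-unit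

guarded-⊢-≢end : ∀ {Γ c P τ} → Guarded c P → Γ ⊢ P ▷ τ → typeAt c τ ≢ end
guarded-⊢-≢end {c = c} inp-guarded (t-inp _)   = typeAt-at-≢end c λ ()
guarded-⊢-≢end {c = c} out-guarded (t-out _ _) = typeAt-at-≢end c λ ()
guarded-⊢-≢end {c = c} sel-guarded (t-inl _)   = typeAt-at-≢end c λ ()
guarded-⊢-≢end {c = c} sel-guarded (t-inr _)   = typeAt-at-≢end c λ ()
guarded-⊢-≢end {c = c} bra-guarded (t-bra _ _) = typeAt-at-≢end c λ ()

waiting-⊢-≢end : ∀ {Γ c P τ} → Waiting c P → Γ ⊢ P ▷ τ → typeAt c τ ≢ end
waiting-⊢-≢end (guarded gP)       dP           = guarded-⊢-≢end gP dP
waiting-⊢-≢end (waiting-left wP)  (t-par dP _) = waiting-⊢-≢end wP dP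
waiting-⊢-≢end (waiting-right wQ) (t-par _ dQ) = waiting-⊢-≢end wQ dQ

guarded-communicate : ∀ {P Q T T' S} → Guarded r P → Guarded l Q →
                      ∅ ⊢ P ▷ (T , T') → ∅ ⊢ Q ▷ (dual T' , S) → Reducible (P ⋈ Q)
guarded-communicate out-guarded inp-guarded (t-out dₑ _) (t-inp _)
  with eval-closed dₑ
... | _ , e⇓ , v∈t = _ , r-comm₁ e⇓ v∈t
guarded-communicate inp-guarded out-guarded (t-inp _) (t-out dₑ _)
  with eval-closed dₑ
... | _ , e⇓ , v∈t = _ , r-comm₂ e⇓ v∈t
guarded-communicate sel-guarded bra-guarded (t-inl _) (t-bra _ _) = _ , r-sel₁
guarded-communicate sel-guarded bra-guarded (t-inr _) (t-bra _ _) = _ , r-sel₁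
guarded-communicate bra-guarded sel-guarded (t-bra _ _) _           = _ , r-sel₂

waiting-communicate : ∀ {P Q T T' S} → Waiting r P → Waiting l Q →
                      ∅ ⊢ P ▷ (T , T') → ∅ ⊢ Q ▷ (dual T' , S) → Reducible (P ⋈ Q)
waiting-communicate (guarded gP) (guarded gQ) dP dQ = guarded-communicate gP gQ dP dQ
waiting-communicate (waiting-right wB) wQ (t-par _ dB) dQ
  with waiting-communicate wB wQ dB dQ
... | _ , B⋈Q⟶ = _ , r-struct (≡-sym ≡-assoc) (r-parR B⋈Q⟶) ≡-refl
waiting-communicate (guarded gP) (waiting-left wC) dP (t-par dC _)
  with waiting-communicate (guarded gP) wC dP dC
... | _ , P⋈C⟶ = _ , r-struct ≡-assoc (r-parL P⋈C⟶) ≡-refl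

dual-≡end : ∀ {T} → dual T ≡ end → T ≡ end
dual-≡end {end} _ = refl

progress-⋈ : ∀ {P Q T T' S} → ∅ ⊢ P ▷ (T , T') → ∅ ⊢ Q ▷ (dual T' , S) →
             Progress P → Progress Q → Progress (P ⋈ Q)
progress-⋈ _  _  (step (_ , P⟶)) _ = step (_ , r-parL P⟶)
progress-⋈ _  _  _ (step (_ , Q⟶)) = step (_ , r-parR Q⟶)
progress-⋈ _  _  (terminated P✓) (terminated Q✓)  = terminated (⋈-terminated P✓ Q✓)
progress-⋈ dP dQ (terminated P✓) (waiting l wQ) with terminated-⊢-end P✓ dP
... | refl = ⊥-elim (waiting-⊢-≢end wQ dQ refl)
progress-⋈ _  _  (terminated _)  (waiting r wQ)  = waiting r (waiting-right wQ)
progress-⋈ _  _  (waiting l wP) _                = waiting l (waiting-left wP)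
progress-⋈ dP dQ (waiting r wP) (terminated Q✓) =
  ⊥-elim (waiting-⊢-≢end wP dP (dual-≡end (cong proj₁ (terminated-⊢-end Q✓ dQ))))
progress-⋈ dP dQ (waiting r wP) (waiting l wQ)  = step (waiting-communicate wP wQ dP dQ)
progress-⋈ _  _  (waiting r _)  (waiting r wQ)  = waiting r (waiting-right wQ)

progress : ∀ {P τ} → ∅ ⊢ P ▷ τ → Progress P
progress t-nil               = terminated 𝟎-terminated
progress (t-inp {c = c} _)   = waiting c (guarded inp-guarded)
progress (t-out {c = c} _ _) = waiting c (guarded out-guarded)
progress (t-bra {c = c} _ _) = waiting c (guarded bra-guarded)
progress (t-inl {c = c} _)   = waiting c (guarded sel-guarded)
progress (t-inr {c = c} _)   = waiting c (guarded sel-guarded)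
progress (t-if dₑ _ _) with eval-closed dₑ
... | boolV _ , e⇓ , bool∈ = step (_ , r-if e⇓)
progress (t-par dP dQ)       = progress-⋈ dP dQ (progress dP) (progress dQ)

stuck-⊢-end-≡𝟎 : ∀ {P} → ∅ ⊢ P ▷ (end , end) → Stuck P → P ≡ₛ 𝟎
stuck-⊢-end-≡𝟎 dP P-stuck with progress dP
... | step P⟶       = ⊥-elim (P-stuck P⟶)
... | terminated P✓ = terminated-≡𝟎 P✓
... | waiting l wP  = ⊥-elim (waiting-⊢-≢end wP dP refl)
... | waiting r wP  = ⊥-elim (waiting-⊢-≢end wP dP refl)

theorem1 : (P : Proc) → ∅ ⊢ P ▷ (end , end) → Correct P
theorem1 P dP Q P⟶*Q Q-stuck = stuck-⊢-end-≡𝟎 (subject-reduction* P⟶*Q dP) Q-stuck
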